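{- For every $n$, there is an injection from $\bar{Q}_3(0,n)$ to $\bar{P}_3(0,n)$.
   Context: Partitions: $\ell(\mu)$ is the number of parts, $s(\mu)$ the smallest part ($s(\emptyset)=+\infty$), $\mu_i=0$ if $\mu$ has fewer than $i$ parts, rank of $\lambda$ is $\lambda_1-\ell(\lambda)$. The rank-set of $\lambda=(\lambda_1\ge\cdots\ge\lambda_\ell>0)$ is $[-\lambda_1,1-\lambda_2,\ldots,\ell-1-\lambda_\ell,\ell,\ell+1,\ldots]$. The Durfee symbol of $\lambda$ is $(\alpha,\beta)_j$, where $j$ is the side of the Durfee square (largest $j$ with $\lambda_j\ge j$, or $0$), $\alpha_i=\lambda'_{j+i}$ are the column lengths to the right of the Durfee square ($\lambda'$ the conjugate) and $\beta=(\lambda_{j+1},\lambda_{j+2},\ldots)$ are the rows below it. $Q(0,n)$ is the set of partitions of $n$ with $0$ in the rank-set; $P(0,n)$ the set of partitions of $n$ with rank $\ge0$. $\bar{Q}_3(0,n)$ is the set of $\lambda\in Q(0,n)$ whose Durfee symbol satisfies $j\ge1$, $\ell(\beta)-\ell(\alpha)\ge1$, $\alpha_1=\alpha_2=j$, $s(\alpha)=1$ and $s(\beta)=2$. $\bar{P}_3(0,n)$ is the set of $\mu\in P(0,n)$ whose Durfee symbol $(\gamma,\delta)_{j'}$ satisfies $j'\ge1$, $\ell(\gamma)=\ell(\delta)$, $\gamma_1\le j'-2$, $\delta_1=j'$ and $s(\delta)=1$. -}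

module Defs where

open import Data.Nat using (ℕ; zero; suc; _+_; _∸_; _≤_; _<_; _≤?_; _⊓_)
open import Data.Integer using (ℤ; +_; 0ℤ) renaming (_-_ to _-ℤ_)
open import Data.Nat.ListAction using (sum)
open import Data.List using (List; []; _∷_; length; map; filter; upTo; drop)
open import Data.List.Relation.Unary.All using (All)
open import Data.List.Relation.Unary.Linked using (Linked)
open import Data.Maybe using (Maybe; just; nothing)
open import Data.Product using (Σ; ∃; _×_; proj₁)
open import Relation.Nullary using (yes; no)
open import Relation.Binary.PropositionalEquality using (_≡_)

IsPartitionOf : ℕ → List ℕ → Set
IsPartitionOf n μ = Linked (λ a b → b ≤ a) μ × All (λ a → 0 < a) μ × sum μ ≡ n

-- μ_i (1-indexed), with μ_i = 0 if μ has fewer than i parts.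
part : List ℕ → ℕ → ℕ
part []       _             = 0
part (x ∷ xs) zero          = 0    -- index 0 is not used
part (x ∷ xs) (suc zero)    = x
part (x ∷ xs) (suc (suc i)) = part xs (suc i)

ℓ : List ℕ → ℕ
ℓ = length

-- smallest part; nothing encodes +∞ (s(∅) = +∞)
s : List ℕ → Maybe ℕ
s []       = nothing
s (x ∷ xs) with s xs
... | nothing = just x
... | just m  = just (x ⊓ m)

conj : List ℕ → ℕ → ℕ
conj μ k = length (filter (λ a → k ≤? a) μ)

-- Durfee side: largest j with λ_j ≥ j (or 0).  For a weakly decreasing list
-- the indices i with λ_i ≥ i form an initial segment, so this counts them.
durfeeFrom : ℕ → List ℕ → ℕ
durfeeFrom i []       = 0
durfeeFrom i (x ∷ xs) with i ≤? x
... | yes _ = suc (durfeeFrom (suc i) xs)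
... | no  _ = 0

durfee : List ℕ → ℕ
durfee = durfeeFrom 1

-- Durfee symbol (α, β)_j
-- α_i = λ'_{j+i} for i = 1 .. λ_1 - j  (column lengths right of the square)
dα : List ℕ → List ℕ
dα μ = map (λ i → conj μ (suc (durfee μ + i))) (upTo (part μ 1 ∸ durfee μ))

dβ : List ℕ → List ℕ
dβ μ = drop (durfee μ) μ

-- rank-set [-λ_1, 1-λ_2, ..., ℓ-1-λ_ℓ, ℓ, ℓ+1, ...]: its k-th entry (k ≥ 0)
-- is k - λ_{k+1} (with λ_{k+1} = 0 for k ≥ ℓ).
InRankSet : ℤ → List ℕ → Set
InRankSet r μ = ∃ λ k → (+ k) -ℤ (+ part μ (suc k)) ≡ r

InQ0 : ℕ → List ℕ → Set
InQ0 n μ = IsPartitionOf n μ × InRankSet 0ℤ μ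

InP0 : ℕ → List ℕ → Set
InP0 n μ = IsPartitionOf n μ × ℓ μ ≤ part μ 1

InQbar3 : ℕ → List ℕ → Set
InQbar3 n μ =
  InQ0 n μ ×
  1 ≤ durfee μ ×
  suc (ℓ (dα μ)) ≤ ℓ (dβ μ) ×
  part (dα μ) 1 ≡ durfee μ ×
  part (dα μ) 2 ≡ durfee μ ×
  s (dα μ) ≡ just 1 ×
  s (dβ μ) ≡ just 2

InPbar3 : ℕ → List ℕ → Set
InPbar3 n μ =
  InP0 n μ ×
  1 ≤ durfee μ ×
  ℓ (dα μ) ≡ ℓ (dβ μ) ×
  part (dα μ) 1 + 2 ≤ durfee μ ×
  part (dβ μ) 1 ≡ durfee μ ×
  s (dβ μ) ≡ just 1

Qbar3 : ℕ → Set
Qbar3 n = Σ (List ℕ) (InQbar3 n)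

Pbar3 : ℕ → Set
Pbar3 n = Σ (List ℕ) (InPbar3 n)

module Submission where

-- Pass to column lengths c = λ′.  For λ ∈ Q̄₃(0,n) with Durfee side j, the condition 0 ∈ rank-set
-- forces λ_{j+1} = j (the Durfee side is the only k with k = λ_{k+1}); with the conditions on α and β
-- this gives c₁ = c₂ = ℓ(λ), c_j > j, c_{j+1} = c_{j+2} = j, c_{λ₁} = 1, j ≥ 2 and j + 3 ≤ λ₁ < ℓ(λ).
-- Dropping c₁, c_{j+1}, c_{j+2}, c_{λ₁} and redistributing their total as three parts j + 1, a 1 added
-- to each of c_{j+3}, …, c_{λ₁−1}, and ℓ(λ) − λ₁ + 1 parts 1 yields μ ∈ P̄₃(0,n) with Durfee side j + 1,
-- μ₁ = ℓ(μ) = ℓ(λ) and γ₁ = μ′_{j+2} ≤ j − 1.  Conversely j is read off as the Durfee side of μ, and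
-- the parts ≥ 2 after the block of three j + 1's give back c_{j+3}, …, c_{λ₁−1}, so c, hence λ, is
-- recovered.

open import Defs
open import Data.Nat
open import Data.Nat.Properties
open import Data.Nat.ListAction using (sum)
open import Data.Nat.ListAction.Properties using (sum-++)
open import Data.List using (List; []; _∷_; length; map; filter; drop; _++_; replicate; applyUpTo; upTo)
open import Data.List.Properties
  using (length-++; length-filter; filter-accept; filter-reject; filter-all; filter-none; filter-++; ∷-injective; ∷-injectiveˡ; ∷-injectiveʳ; length-replicate; length-map; length-upTo; length-drop; map-injective)
open import Data.List.Relation.Unary.All as All using (All; []; _∷_)
open import Data.List.Relation.Unary.Linked as Linked using (Linked; []; [-]; _∷_)
open import Data.List.Relation.Unary.Linked.Properties as Linked using (Linked⇒All)
import Data.List.Relation.Unary.All.Properties as All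
import Data.Integer.Properties as ℤ
open import Data.Integer using (0ℤ)
open import Data.Maybe using (just; nothing)
open import Data.Product using (Σ; ∃; _×_; _,_; proj₁)
open import Data.Sum using (inj₁; inj₂)
open import Relation.Binary.Definitions using (tri<; tri≈; tri>)
open import Data.Empty using (⊥-elim)
open import Data.Nat.Solver using (module +-*-Solver)
open import Function using (flip; id; _∘′_)
open import Algebra.Properties.CommutativeSemigroup +-commutativeSemigroup using (interchange)
open import Relation.Nullary using (yes; no; contradiction)
open import Relation.Binary.PropositionalEquality
  using (_≡_; _≢_; ≢-sym; refl; sym; trans; cong; cong₂; subst; subst₂; module ≡-Reasoning)

m<n∸o⇒o+m<n : ∀ m n o → m < n ∸ o → o + m < n
m<n∸o⇒o+m<n m n       zero    m<n   = m<n
m<n∸o⇒o+m<n m (suc n) (suc o) m<n∸o = s≤s (m<n∸o⇒o+m<n m n o m<n∸o)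

++-injective : ∀ {A : Set} (xs₁ xs₂ ys₁ ys₂ : List A) → length xs₁ ≡ length xs₂ →
               xs₁ ++ ys₁ ≡ xs₂ ++ ys₂ → xs₁ ≡ xs₂ × ys₁ ≡ ys₂
++-injective []        []        ys₁ ys₂ _  eq = refl , eq
++-injective (x₁ ∷ xs₁) (x₂ ∷ xs₂) ys₁ ys₂ ℓ≡ eq with ∷-injective eq
... | refl , eq′ with ++-injective xs₁ xs₂ ys₁ ys₂ (suc-injective ℓ≡) eq′
... | refl , ys≡ = refl , ys≡

++-replicate-1-injective : ∀ xs ys m n → All (2 ≤_) xs → All (2 ≤_) ys →
                           xs ++ replicate m 1 ≡ ys ++ replicate n 1 → xs ≡ ys × m ≡ n
++-replicate-1-injective []       []       m n _ _ eq =
  refl , trans (sym (length-replicate m)) (trans (cong length eq) (length-replicate n))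
++-replicate-1-injective []       (y ∷ ys) (suc m) n _ (2≤y ∷ _) eq =
  contradiction (∷-injectiveˡ eq) (λ 1≡y → <⇒≱ 2≤y (≤-reflexive (sym 1≡y)))
++-replicate-1-injective (x ∷ xs) []       m (suc n) (2≤x ∷ _) _ eq =
  contradiction (∷-injectiveˡ eq) (λ x≡1 → <⇒≱ 2≤x (≤-reflexive x≡1))
++-replicate-1-injective (x ∷ xs) (y ∷ ys) m n (_ ∷ pxs) (_ ∷ pys) eq with ∷-injective eq
... | refl , eq′ with ++-replicate-1-injective xs ys m n pxs pys eq′
... | refl , m≡n = refl , m≡n

drop-++ : ∀ {A : Set} (xs ys : List A) m k → length xs ≡ m → drop (m + k) (xs ++ ys) ≡ drop k ys
drop-++ []       ys _ k refl = refl
drop-++ (x ∷ xs) ys _ k refl = drop-++ xs ys (length xs) k refl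

sum-replicate-1 : ∀ m → sum (replicate m 1) ≡ m
sum-replicate-1 zero    = refl
sum-replicate-1 (suc m) = cong suc (sum-replicate-1 m)

sum-map-suc : ∀ xs → sum (map suc xs) ≡ sum xs + length xs
sum-map-suc []       = refl
sum-map-suc (x ∷ xs) = begin
  suc (x + sum (map suc xs))        ≡⟨ cong (λ t → suc (x + t)) (sum-map-suc xs) ⟩
  suc (x + (sum xs + length xs))    ≡⟨ cong suc (+-assoc x (sum xs) (length xs)) ⟨
  suc (x + sum xs + length xs)      ≡⟨ +-suc (x + sum xs) (length xs) ⟨
  x + sum xs + suc (length xs)      ∎
  where open ≡-Reasoning

Descending : List ℕ → Set
Descending = Linked (λ a b → b ≤ a)

All-≤-head : ∀ {x xs} → Descending (x ∷ xs) → All (_≤ x) (x ∷ xs)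
All-≤-head = Linked⇒All (flip ≤-trans) ≤-refl

All-≤-part₁ : ∀ xs → Descending xs → All (_≤ part xs 1) xs
All-≤-part₁ []       _ = []
All-≤-part₁ (x ∷ xs) d = All-≤-head d

Descending-++ : ∀ {xs ys} b → Descending xs → Descending ys →
                All (b ≤_) xs → All (_≤ b) ys → Descending (xs ++ ys)
Descending-++ b []        dys       _          _         = dys
Descending-++ b [-]       []        _          _         = [-]
Descending-++ b [-]       [-]       (b≤x ∷ []) (y≤b ∷ _) = ≤-trans y≤b b≤x ∷ [-]
Descending-++ b [-]       (r ∷ dys) (b≤x ∷ []) (y≤b ∷ _) = ≤-trans y≤b b≤x ∷ r ∷ dys
Descending-++ b (r ∷ dxs) dys       (_ ∷ ps)   qs        = r ∷ Descending-++ b dxs dys ps qs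

replicate-descending : ∀ q x → Descending (replicate q x)
replicate-descending zero          x = []
replicate-descending (suc zero)    x = [-]
replicate-descending (suc (suc q)) x = ≤-refl ∷ replicate-descending (suc q) x

part-≤ : ∀ {x} ys i → All (_≤ x) ys → part ys i ≤ x
part-≤ []       i             _        = z≤n
part-≤ (y ∷ ys) zero          _        = z≤n
part-≤ (y ∷ ys) (suc zero)    (p ∷ _)  = p
part-≤ (y ∷ ys) (suc (suc i)) (_ ∷ ps) = part-≤ ys (suc i) ps

part-antitone : ∀ xs {m m′} → Descending xs → m ≤ m′ → part xs (suc m′) ≤ part xs (suc m)
part-antitone []       _ _ = z≤n
part-antitone (x ∷ xs) {zero} {m′}      d _         = part-≤ (x ∷ xs) (suc m′) (All-≤-head d)
part-antitone (x ∷ xs) {suc m} {suc m′} d (s≤s m≤m′) = part-antitone xs (Linked.tail d) m≤m′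

part≢0⇒<length : ∀ xs i → part xs (suc i) ≢ 0 → i < length xs
part≢0⇒<length []       i       p≢0 = contradiction refl p≢0
part≢0⇒<length (x ∷ xs) zero    p≢0 = z<s
part≢0⇒<length (x ∷ xs) (suc i) p≢0 = s≤s (part≢0⇒<length xs i p≢0)

All-part : ∀ {P : ℕ → Set} ys i → All P ys → i < length ys → P (part ys (suc i))
All-part (y ∷ ys) zero    (p ∷ _)  _         = p
All-part (y ∷ ys) (suc i) (_ ∷ ps) (s≤s i<ℓ) = All-part ys i ps i<ℓ

All-part-drop : ∀ {P : ℕ → Set} xs d i → All P (drop d xs) → d ≤ i → i < length xs → P (part xs (suc i))
All-part-drop xs       zero    i       ps _         i<ℓ       = All-part xs i ps i<ℓ
All-part-drop (x ∷ xs) (suc d) (suc i) ps (s≤s d≤i) (s≤s i<ℓ) = All-part-drop xs d i ps d≤i i<ℓ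

part-map-applyUpTo : ∀ (g h : ℕ → ℕ) m i → i < m → part (map g (applyUpTo h m)) (suc i) ≡ g (h i)
part-map-applyUpTo g h (suc m) zero    _         = refl
part-map-applyUpTo g h (suc m) (suc i) (s≤s i<m) = part-map-applyUpTo g (h ∘′ suc) m i i<m

part-map-applyUpTo-≥ : ∀ (g h : ℕ → ℕ) m i → m ≤ i → part (map g (applyUpTo h m)) (suc i) ≡ 0
part-map-applyUpTo-≥ g h zero    i       _         = refl
part-map-applyUpTo-≥ g h (suc m) (suc i) (s≤s m≤i) = part-map-applyUpTo-≥ g (h ∘′ suc) m i m≤i

segment : {A : Set} → (ℕ → A) → ℕ → ℕ → List A
segment f b zero    = []
segment f b (suc m) = f b ∷ segment f (suc b) m

length-segment : ∀ {A : Set} (f : ℕ → A) b m → length (segment f b m) ≡ m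
length-segment f b zero    = refl
length-segment f b (suc m) = cong suc (length-segment f (suc b) m)

segment-++ : ∀ {A : Set} (f : ℕ → A) b m m′ →
             segment f b (m + m′) ≡ segment f b m ++ segment f (b + m) m′
segment-++ f b zero    m′ rewrite +-identityʳ b = refl
segment-++ f b (suc m) m′ rewrite +-suc b m = cong (f b ∷_) (segment-++ f (suc b) m m′)

segment-cong : ∀ {A : Set} (f g : ℕ → A) b m →
               (∀ i → i < m → f (b + i) ≡ g (b + i)) → segment f b m ≡ segment g b m
segment-cong f g b zero    eq = refl
segment-cong f g b (suc m) eq = cong₂ _∷_ head-eq (segment-cong f g (suc b) m tail-eq)
  where
  head-eq : f b ≡ g b
  head-eq = subst (λ x → f x ≡ g x) (+-identityʳ b) (eq 0 z<s)
  tail-eq : ∀ i → i < m → f (suc b + i) ≡ g (suc b + i)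
  tail-eq i i<m = subst (λ x → f x ≡ g x) (+-suc b i) (eq (suc i) (s≤s i<m))

segment-injective : ∀ {A : Set} (f g : ℕ → A) b m →
                    segment f b m ≡ segment g b m → ∀ i → i < m → f (b + i) ≡ g (b + i)
segment-injective f g b (suc m) eq zero    _ rewrite +-identityʳ b = ∷-injectiveˡ eq
segment-injective f g b (suc m) eq (suc i) (s≤s i<m) rewrite +-suc b i =
  segment-injective f g (suc b) m (∷-injectiveʳ eq) i i<m

All-segment : ∀ {A : Set} {P : A → Set} (f : ℕ → A) b m →
              (∀ i → i < m → P (f (b + i))) → All P (segment f b m)
All-segment f b zero    h = []
All-segment {P = P} f b (suc m) h =
  subst (P ∘′ f) (+-identityʳ b) (h 0 z<s) ∷
  All-segment f (suc b) m (λ i i<m → subst (P ∘′ f) (+-suc b i) (h (suc i) (s≤s i<m)))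

segment-descending : ∀ (f : ℕ → ℕ) b m → (∀ k → f (suc k) ≤ f k) → Descending (segment f b m)
segment-descending f b zero          step = []
segment-descending f b (suc zero)    step = [-]
segment-descending f b (suc (suc m)) step = step b ∷ segment-descending f (suc b) (suc m) step

sum-segment-+ : ∀ (f g : ℕ → ℕ) b m →
                sum (segment (λ k → f k + g k) b m) ≡ sum (segment f b m) + sum (segment g b m)
sum-segment-+ f g b zero    = refl
sum-segment-+ f g b (suc m) rewrite sum-segment-+ f g (suc b) m =
  interchange (f b) (g b) (sum (segment f (suc b) m)) (sum (segment g (suc b) m))

-- The conjugate partition

conj-∷-≤ : ∀ {x xs k} → k ≤ x → conj (x ∷ xs) k ≡ suc (conj xs k)
conj-∷-≤ {k = k} k≤x = cong length (filter-accept (k ≤?_) k≤x)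

conj-∷-< : ∀ {x xs k} → x < k → conj (x ∷ xs) k ≡ conj xs k
conj-∷-< {k = k} x<k = cong length (filter-reject (k ≤?_) (<⇒≱ x<k))

conj-++ : ∀ xs ys k → conj (xs ++ ys) k ≡ conj xs k + conj ys k
conj-++ xs ys k = trans (cong length (filter-++ (k ≤?_) xs ys)) (length-++ (filter (k ≤?_) xs))

conj-≤-length : ∀ xs k → conj xs k ≤ length xs
conj-≤-length xs k = length-filter (k ≤?_) xs

conj-all : ∀ xs k → All (k ≤_) xs → conj xs k ≡ length xs
conj-all xs k ps = cong length (filter-all (k ≤?_) ps)

conj-none : ∀ xs k → All (_< k) xs → conj xs k ≡ 0
conj-none xs k ps = cong length (filter-none (k ≤?_) (All.map <⇒≱ ps))

conj-antitone : ∀ xs {k k′} → k ≤ k′ → conj xs k′ ≤ conj xs k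
conj-antitone []       k≤k′ = z≤n
conj-antitone (x ∷ xs) {k} {k′} k≤k′ with k ≤? x | k′ ≤? x
... | yes k≤x | yes k′≤x rewrite conj-∷-≤ {x} {xs} k≤x | conj-∷-≤ {x} {xs} k′≤x =
  s≤s (conj-antitone xs k≤k′)
... | yes k≤x | no  k′≰x rewrite conj-∷-≤ {x} {xs} k≤x | conj-∷-< {x} {xs} (≰⇒> k′≰x) =
  m≤n⇒m≤1+n (conj-antitone xs k≤k′)
... | no  k≰x | yes k′≤x = contradiction (≤-trans k≤k′ k′≤x) k≰x
... | no  k≰x | no  k′≰x rewrite conj-∷-< {x} {xs} (≰⇒> k≰x) | conj-∷-< {x} {xs} (≰⇒> k′≰x) =
  conj-antitone xs k≤k′

≤-part⇒≤-conj : ∀ xs i {k} → Descending xs → 1 ≤ k → k ≤ part xs (suc i) → suc i ≤ conj xs k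
≤-part⇒≤-conj []       i       _ 1≤k k≤0 = contradiction k≤0 (<⇒≱ 1≤k)
≤-part⇒≤-conj (x ∷ xs) zero    _ _   k≤x rewrite conj-∷-≤ {x} {xs} k≤x = s≤s z≤n
≤-part⇒≤-conj (x ∷ xs) (suc i) d 1≤k k≤λ
  rewrite conj-∷-≤ {x} {xs} (≤-trans k≤λ (part-antitone (x ∷ xs) {0} {suc i} d z≤n)) =
  s≤s (≤-part⇒≤-conj xs i (Linked.tail d) 1≤k k≤λ)

≤-conj⇒≤-part : ∀ xs i {k} → Descending xs → suc i ≤ conj xs k → k ≤ part xs (suc i)
≤-conj⇒≤-part (x ∷ xs) i {k} d i<c with k ≤? x
≤-conj⇒≤-part (x ∷ xs) zero    d i<c | yes k≤x = k≤x
≤-conj⇒≤-part (x ∷ xs) (suc i) d i<c | yes k≤x rewrite conj-∷-≤ {x} {xs} k≤x =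
  ≤-conj⇒≤-part xs i (Linked.tail d) (≤-pred i<c)
≤-conj⇒≤-part (x ∷ xs) i {k} d i<c | no k≰x = contradiction i<c (<⇒≱ (subst (_< suc i) (sym no-parts) z<s))
  where
  no-parts : conj (x ∷ xs) k ≡ 0
  no-parts = conj-none (x ∷ xs) k (All.map (λ y≤x → ≤-<-trans y≤x (≰⇒> k≰x)) (All-≤-head d))

conj-distinguishes-heads : ∀ {x xs y ys} → Descending (x ∷ xs) → x < y →
                           conj (x ∷ xs) y ≢ conj (y ∷ ys) y
conj-distinguishes-heads {x} {xs} {y} {ys} d x<y eq = 0≢1+n (begin
  0                  ≡⟨ conj-none (x ∷ xs) y (All.map (λ z≤x → ≤-<-trans z≤x x<y) (All-≤-head d)) ⟨
  conj (x ∷ xs) y    ≡⟨ eq ⟩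
  conj (y ∷ ys) y    ≡⟨ conj-∷-≤ {y} {ys} ≤-refl ⟩
  suc (conj ys y)    ∎)
  where open ≡-Reasoning

conj-injective : ∀ xs ys → Descending xs → Descending ys → All (0 <_) xs → All (0 <_) ys →
                 (∀ k → 1 ≤ k → conj xs k ≡ conj ys k) → xs ≡ ys
conj-injective []       []       _  _  _        _        _  = refl
conj-injective []       (y ∷ ys) _  _  _        (0<y ∷ _) eq = ⊥-elim (0≢1+n (trans (eq 1 ≤-refl) (conj-∷-≤ {y} {ys} 0<y)))
conj-injective (x ∷ xs) []       _  _  (0<x ∷ _) _        eq = ⊥-elim (0≢1+n (trans (sym (eq 1 ≤-refl)) (conj-∷-≤ {x} {xs} 0<x)))
conj-injective (x ∷ xs) (y ∷ ys) dx dy (0<x ∷ pxs) (0<y ∷ pys) eq with <-cmp x y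
... | tri< x<y _ _ = contradiction (eq y (≤-trans 0<x (<⇒≤ x<y))) (conj-distinguishes-heads dx x<y)
... | tri> _ _ y<x = contradiction (sym (eq x (≤-trans 0<y (<⇒≤ y<x)))) (conj-distinguishes-heads dy y<x)
... | tri≈ _ refl _ = cong (x ∷_)
  (conj-injective xs ys (Linked.tail dx) (Linked.tail dy) pxs pys tails-eq)
  where
  tails-eq : ∀ k → 1 ≤ k → conj xs k ≡ conj ys k
  tails-eq k 1≤k = +-cancelˡ-≡ (conj (x ∷ []) k) _ _
    (trans (sym (conj-++ (x ∷ []) xs k)) (trans (eq k 1≤k) (conj-++ (x ∷ []) ys k)))

sum-segment-conj-[-] : ∀ x b m → x < b + m → sum (segment (conj (x ∷ [])) b m) ≡ suc x ∸ b
sum-segment-conj-[-] x b zero    x<b rewrite +-identityʳ b = sym (m≤n⇒m∸n≡0 x<b)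
sum-segment-conj-[-] x b (suc m) x<b+m with b ≤? x
... | yes b≤x rewrite conj-∷-≤ {x} {[]} b≤x | sum-segment-conj-[-] x (suc b) m (subst (x <_) (+-suc b m) x<b+m) =
  sym (+-∸-assoc 1 b≤x)
... | no  b≰x rewrite conj-∷-< {x} {[]} (≰⇒> b≰x) | sum-segment-conj-[-] x (suc b) m (subst (x <_) (+-suc b m) x<b+m) =
  trans (m≤n⇒m∸n≡0 (<⇒≤ (≰⇒> b≰x))) (sym (m≤n⇒m∸n≡0 (≰⇒> b≰x)))

sum-segment-conj : ∀ xs a → All (_≤ a) xs → sum (segment (conj xs) 1 a) ≡ sum xs
sum-segment-conj []       a _          = sum-segment-zero 1 a
  where
  sum-segment-zero : ∀ b m → sum (segment (conj []) b m) ≡ 0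
  sum-segment-zero b zero    = refl
  sum-segment-zero b (suc m) = sum-segment-zero (suc b) m
sum-segment-conj (x ∷ xs) a (x≤a ∷ ps) = begin
  sum (segment (conj (x ∷ xs)) 1 a)
    ≡⟨ cong sum (segment-cong _ _ 1 a (λ i _ → conj-++ (x ∷ []) xs (suc i))) ⟩
  sum (segment (λ k → conj (x ∷ []) k + conj xs k) 1 a)
    ≡⟨ sum-segment-+ (conj (x ∷ [])) (conj xs) 1 a ⟩
  sum (segment (conj (x ∷ [])) 1 a) + sum (segment (conj xs) 1 a)
    ≡⟨ cong₂ _+_ (sum-segment-conj-[-] x 1 a (s≤s x≤a)) (sum-segment-conj xs a ps) ⟩
  x + sum xs ∎
  where open ≡-Reasoning

-- Durfee symbols, rank-set and smallest parts

durfeeFrom-∷-≤ : ∀ {b x xs} → b ≤ x → durfeeFrom b (x ∷ xs) ≡ suc (durfeeFrom (suc b) xs)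
durfeeFrom-∷-≤ {b} {x} b≤x with b ≤? x
... | yes _   = refl
... | no b≰x = contradiction b≤x b≰x

durfeeFrom-∷-< : ∀ {b x xs} → x < b → durfeeFrom b (x ∷ xs) ≡ 0
durfeeFrom-∷-< {b} {x} x<b with b ≤? x
... | yes b≤x = contradiction b≤x (<⇒≱ x<b)
... | no _    = refl

≤-part-below-durfeeFrom : ∀ b xs i → i < durfeeFrom b xs → b + i ≤ part xs (suc i)
≤-part-below-durfeeFrom b (x ∷ xs) i i<d with b ≤? x
≤-part-below-durfeeFrom b (x ∷ xs) zero    i<d | yes b≤x rewrite +-identityʳ b = b≤x
≤-part-below-durfeeFrom b (x ∷ xs) (suc i) i<d | yes b≤x rewrite +-suc b i =
  ≤-part-below-durfeeFrom (suc b) xs i (≤-pred i<d)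

part-durfeeFrom-< : ∀ b xs → 1 ≤ b → part xs (suc (durfeeFrom b xs)) < b + durfeeFrom b xs
part-durfeeFrom-< b []       1≤b rewrite +-identityʳ b = 1≤b
part-durfeeFrom-< b (x ∷ xs) 1≤b with b ≤? x
... | yes _   rewrite +-suc b (durfeeFrom (suc b) xs) = part-durfeeFrom-< (suc b) xs (m≤n⇒m≤1+n 1≤b)
... | no  b≰x rewrite +-identityʳ b = ≰⇒> b≰x

durfeeFrom-++ : ∀ K b A ys → All (K ≤_) A → b + length A ≤ suc K →
                durfeeFrom b (A ++ ys) ≡ length A + durfeeFrom (b + length A) ys
durfeeFrom-++ K b []      ys _          _ rewrite +-identityʳ b = refl
durfeeFrom-++ K b (x ∷ A) ys (K≤x ∷ ps) b+ℓ≤K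
  rewrite +-suc b (length A)
        | durfeeFrom-∷-≤ {b} {x} {A ++ ys} (≤-trans (≤-pred (≤-trans (s≤s (m≤m+n b (length A))) b+ℓ≤K)) K≤x) =
  cong suc (durfeeFrom-++ K (suc b) A ys ps b+ℓ≤K)

InRankSet-0⇒part-durfee : ∀ μ → Descending μ → InRankSet 0ℤ μ → part μ (suc (durfee μ)) ≡ durfee μ
InRankSet-0⇒part-durfee μ d (k , k-λ≡0) with k≡λ ← ℤ.+-injective (ℤ.i-j≡0⇒i≡j _ _ k-λ≡0) | <-cmp k (durfee μ)
... | tri< k<j _ _ = contradiction (≤-part-below-durfeeFrom 1 μ k k<j) (<⇒≱ (≤-reflexive (cong suc (sym k≡λ))))
... | tri≈ _ refl _ = sym k≡λ
... | tri> _ _ j<k = contradiction (≤-reflexive k≡λ)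
  (<⇒≱ (≤-<-trans (part-antitone μ d (<⇒≤ j<k)) (≤-trans (part-durfeeFrom-< 1 μ ≤-refl) j<k)))

length-dα : ∀ μ → ℓ (dα μ) ≡ part μ 1 ∸ durfee μ
length-dα μ = trans (length-map _ (upTo (part μ 1 ∸ durfee μ))) (length-upTo (part μ 1 ∸ durfee μ))

length-dβ : ∀ μ → ℓ (dβ μ) ≡ length μ ∸ durfee μ
length-dβ μ = length-drop (durfee μ) μ

part-dα : ∀ μ i → i < part μ 1 ∸ durfee μ → part (dα μ) (suc i) ≡ conj μ (suc (durfee μ + i))
part-dα μ = part-map-applyUpTo (λ i → conj μ (suc (durfee μ + i))) id (part μ 1 ∸ durfee μ)

part-dα-≥ : ∀ μ i → part μ 1 ∸ durfee μ ≤ i → part (dα μ) (suc i) ≡ 0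
part-dα-≥ μ = part-map-applyUpTo-≥ (λ i → conj μ (suc (durfee μ + i))) id (part μ 1 ∸ durfee μ)

s≡nothing⇒[] : ∀ ys → s ys ≡ nothing → ys ≡ []
s≡nothing⇒[] []       _ = refl
s≡nothing⇒[] (y ∷ ys) e with s ys
s≡nothing⇒[] (y ∷ ys) () | nothing
s≡nothing⇒[] (y ∷ ys) () | just _

s≡just⇒∃part : ∀ ys m → s ys ≡ just m → ∃ λ i → i < length ys × part ys (suc i) ≡ m
s≡just⇒∃part (y ∷ ys) m e with s ys in e′
s≡just⇒∃part (y ∷ ys) m refl | nothing = 0 , z<s , refl
s≡just⇒∃part (y ∷ ys) m refl | just m′ with ⊓-sel y m′
... | inj₁ y⊓m′≡y  = 0 , z<s , sym y⊓m′≡y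
... | inj₂ y⊓m′≡m′ with s≡just⇒∃part ys m′ e′
... | i , i<ℓ , λᵢ≡m′ = suc i , s≤s i<ℓ , trans λᵢ≡m′ (sym y⊓m′≡m′)

s≡just⇒All-≥ : ∀ ys m → s ys ≡ just m → All (m ≤_) ys
s≡just⇒All-≥ (y ∷ ys) m e with s ys in e′
s≡just⇒All-≥ (y ∷ ys) m refl | nothing rewrite s≡nothing⇒[] ys e′ = ≤-refl ∷ []
s≡just⇒All-≥ (y ∷ ys) m refl | just m′ =
  m⊓n≤m y m′ ∷ All.map (≤-trans (m⊓n≤n y m′)) (s≡just⇒All-≥ ys m′ e′)

s-++-replicate-1 : ∀ xs q → All (1 ≤_) xs → s (xs ++ replicate (suc q) 1) ≡ just 1
s-++-replicate-1 []       zero    _        = refl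
s-++-replicate-1 []       (suc q) _        rewrite s-++-replicate-1 [] q [] = refl
s-++-replicate-1 (x ∷ xs) q       (p ∷ ps) rewrite s-++-replicate-1 xs q ps = cong just (m≥n⇒m⊓n≡n p)

-- The injection

-- Column lengths c = λ′ of some λ ∈ Q̄₃(0,n) with Durfee side j = j′ + 2, λ₁ = j′ + p + 5 and
-- ℓ(λ) = j′ + p + q + 5; the offsets keep every length free of truncated subtraction.
record Qbar3Columns (c : ℕ → ℕ) (j′ p q n : ℕ) : Set where
  field
    antitone   : ∀ {k k′} → k ≤ k′ → c k′ ≤ c k
    c-1        : c 1 ≡ 5 + j′ + p + q
    c-2        : c 2 ≡ 5 + j′ + p + q
    c-durfee   : 3 + j′ ≤ c (2 + j′)
    c-durfee+1 : c (3 + j′) ≡ 2 + j′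
    c-durfee+2 : c (4 + j′) ≡ 2 + j′
    c-λ₁       : c (5 + j′ + p) ≡ 1
    c-beyond   : ∀ k → 5 + j′ + p < k → c k ≡ 0
    sum-c      : sum (segment c 1 (5 + j′ + p)) ≡ n

qbar3Columns-intro : ∀ {c : ℕ → ℕ} {n j a L j′ p q} → j ≡ 2 + j′ → a ≡ 3 + j + p → L ≡ a + q →
  (∀ {k k′} → k ≤ k′ → c k′ ≤ c k) → c 1 ≡ L → c 2 ≡ L →
  suc j ≤ c j → c (1 + j) ≡ j → c (2 + j) ≡ j → c a ≡ 1 →
  (∀ k → a < k → c k ≡ 0) → sum (segment c 1 a) ≡ n → Qbar3Columns c j′ p q n
qbar3Columns-intro refl refl refl antitone c-1 c-2 c-j c-j+1 c-j+2 c-a c-beyond sum-c =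
  record { antitone = antitone ; c-1 = c-1 ; c-2 = c-2 ; c-durfee = c-j ; c-durfee+1 = c-j+1
         ; c-durfee+2 = c-j+2 ; c-λ₁ = c-a ; c-beyond = c-beyond ; sum-c = sum-c }

-- (c₂, …, c_j, j+1, j+1, j+1, c_{j+3}+1, …, c_{λ₁−1}+1, 1, …, 1) with ℓ(λ) − λ₁ + 1 final 1s
image : (ℕ → ℕ) → ℕ → ℕ → ℕ → List ℕ
image c j′ p q =
  segment c 2 (suc j′) ++ (3 + j′ ∷ 3 + j′ ∷ 3 + j′ ∷ map suc (segment c (5 + j′) p) ++ replicate (suc q) 1)

segment-split : ∀ {A : Set} (c : ℕ → A) j′ p → segment c 1 (5 + j′ + p) ≡
  c 1 ∷ segment c 2 (suc j′) ++ c (3 + j′) ∷ c (4 + j′) ∷ segment c (5 + j′) p ++ c (5 + j′ + p) ∷ []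
segment-split c j′ p = begin
  segment c 1 (5 + j′ + p)
    ≡⟨ cong (segment c 1) (+-*-Solver.solve 2 (λ j′ p → con 5 :+ j′ :+ p := con 2 :+ j′ :+ (con 2 :+ (p :+ con 1))) refl j′ p) ⟩
  c 1 ∷ segment c 2 (suc j′ + (2 + (p + 1)))
    ≡⟨ cong (c 1 ∷_) (segment-++ c 2 (suc j′) (2 + (p + 1))) ⟩
  c 1 ∷ segment c 2 (suc j′) ++ c (3 + j′) ∷ c (4 + j′) ∷ segment c (5 + j′) (p + 1)
    ≡⟨ cong (λ t → c 1 ∷ segment c 2 (suc j′) ++ c (3 + j′) ∷ c (4 + j′) ∷ t) (segment-++ c (5 + j′) p 1) ⟩
  c 1 ∷ segment c 2 (suc j′) ++ c (3 + j′) ∷ c (4 + j′) ∷ segment c (5 + j′) p ++ c (5 + j′ + p) ∷ [] ∎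
  where open ≡-Reasoning
        open +-*-Solver using (_:+_; _:=_; con)

module Image {c : ℕ → ℕ} {j′ p q n : ℕ} (H : Qbar3Columns c j′ p q n) where
  open Qbar3Columns H

  J : ℕ
  J = 3 + j′

  A M T μ : List ℕ
  A = segment c 2 (suc j′)
  M = map suc (segment c (5 + j′) p)
  T = M ++ replicate (suc q) 1
  μ = image c j′ p q

  length-A : length A ≡ suc j′
  length-A = length-segment c 2 (suc j′)

  A-≥ : All (J ≤_) A
  A-≥ = All-segment c 2 (suc j′) (λ i i<1+j′ → ≤-trans c-durfee (antitone (s≤s (s≤s (≤-pred i<1+j′)))))

  M-≤ : All (_≤ J) M
  M-≤ = All.map⁺ (All-segment c (5 + j′) p (λ i _ →
    s≤s (≤-trans (antitone (≤-trans (n≤1+n (4 + j′)) (m≤m+n (5 + j′) i))) (≤-reflexive c-durfee+2))))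

  M-≥ : All (2 ≤_) M
  M-≥ = All.map⁺ (All-segment c (5 + j′) p (λ i i<p →
    s≤s (≤-trans (≤-reflexive (sym c-λ₁)) (antitone (+-monoʳ-≤ (5 + j′) (<⇒≤ i<p))))))

  T-≤ : All (_≤ J) T
  T-≤ = All.++⁺ M-≤ (All.replicate⁺ (suc q) (s≤s z≤n))

  descending : Descending μ
  descending = Descending-++ J (segment-descending c 2 (suc j′) (λ k → antitone (n≤1+n k)))
    (≤-refl ∷ ≤-refl ∷ Descending-++ J [-] T-descending (≤-refl ∷ []) T-≤)
    A-≥ (≤-refl ∷ ≤-refl ∷ ≤-refl ∷ T-≤)
    where
    T-descending : Descending T
    T-descending = Descending-++ 1
      (Linked.map⁺ {f = suc} (Linked.map s≤s (segment-descending c (5 + j′) p (λ k → antitone (n≤1+n k)))))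
      (replicate-descending (suc q) 1)
      (All.map (≤-trans (s≤s z≤n)) M-≥) (All.replicate⁺ (suc q) ≤-refl)

  positive : All (0 <_) μ
  positive = All.++⁺ (All.map (≤-trans (s≤s z≤n)) A-≥)
    (z<s ∷ z<s ∷ z<s ∷ All.++⁺ (All.map (≤-trans (s≤s z≤n)) M-≥) (All.replicate⁺ (suc q) z<s))

  sum-image : sum μ ≡ n
  sum-image = begin
    sum μ
      ≡⟨ sum-++ A (J ∷ J ∷ J ∷ T) ⟩
    sum A + (J + (J + (J + sum T)))
      ≡⟨ cong (λ t → sum A + (J + (J + (J + t)))) sum-T ⟩
    sum A + (J + (J + (J + (sum S + p + suc q))))
      ≡⟨ +-*-Solver.solve 5 (λ a s j′ p q →
           a :+ ((con 3 :+ j′) :+ ((con 3 :+ j′) :+ ((con 3 :+ j′) :+ (s :+ p :+ (con 1 :+ q)))))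
           := (con 5 :+ j′ :+ p :+ q) :+ (a :+ ((con 2 :+ j′) :+ ((con 2 :+ j′) :+ (s :+ (con 1 :+ con 0))))))
           refl (sum A) (sum S) j′ p q ⟩
    (5 + j′ + p + q) + (sum A + ((2 + j′) + ((2 + j′) + (sum S + (1 + 0)))))
      ≡⟨ cong₂ _+_ c-1 (cong (sum A +_) (cong₂ _+_ c-durfee+1 (cong₂ _+_ c-durfee+2
           (cong (λ t → sum S + (t + 0)) c-λ₁)))) ⟨
    c 1 + (sum A + (c (3 + j′) + (c (4 + j′) + (sum S + (c (5 + j′ + p) + 0)))))
      ≡⟨ cong (c 1 +_) (trans (sum-++ A _) (cong (λ t → sum A + (c (3 + j′) + (c (4 + j′) + t)))
           (sum-++ S (c (5 + j′ + p) ∷ [])))) ⟨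
    sum (c 1 ∷ A ++ c (3 + j′) ∷ c (4 + j′) ∷ S ++ c (5 + j′ + p) ∷ [])
      ≡⟨ cong sum (segment-split c j′ p) ⟨
    sum (segment c 1 (5 + j′ + p))
      ≡⟨ sum-c ⟩
    n ∎
    where
    open ≡-Reasoning
    open +-*-Solver using (_:+_; _:=_; con)
    S : List ℕ
    S = segment c (5 + j′) p
    sum-T : sum T ≡ sum S + p + suc q
    sum-T = begin
      sum T                                 ≡⟨ sum-++ M (replicate (suc q) 1) ⟩
      sum M + sum (replicate (suc q) 1)     ≡⟨ cong₂ _+_ (sum-map-suc S) (sum-replicate-1 (suc q)) ⟩
      sum S + length S + suc q              ≡⟨ cong (λ t → sum S + t + suc q) (length-segment c (5 + j′) p) ⟩
      sum S + p + suc q                     ∎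

  length-image : length μ ≡ 5 + j′ + p + q
  length-image = begin
    length μ
      ≡⟨ length-++ A ⟩
    length A + (3 + length T)
      ≡⟨ cong₂ (λ a t → a + (3 + t)) length-A
           (trans (length-++ M) (cong₂ _+_ (trans (length-map suc (segment c (5 + j′) p)) (length-segment c (5 + j′) p))
                                          (length-replicate (suc q)))) ⟩
    suc j′ + (3 + (p + suc q))
      ≡⟨ +-*-Solver.solve 3 (λ j′ p q → (con 1 :+ j′) :+ (con 3 :+ (p :+ (con 1 :+ q)))
                                         := con 5 :+ j′ :+ p :+ q) refl j′ p q ⟩
    5 + j′ + p + q ∎
    where
    open ≡-Reasoning
    open +-*-Solver using (_:+_; _:=_; con)

  durfee-image : durfee μ ≡ J
  durfee-image = begin
    durfee μ
      ≡⟨ durfeeFrom-++ J 1 A (J ∷ J ∷ J ∷ T) A-≥ (≤-trans (≤-reflexive (cong suc length-A)) (m≤n+m (2 + j′) 2)) ⟩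
    length A + durfeeFrom (1 + length A) (J ∷ J ∷ J ∷ T)
      ≡⟨ cong (λ a → a + durfeeFrom (1 + a) (J ∷ J ∷ J ∷ T)) length-A ⟩
    suc j′ + durfeeFrom (2 + j′) (J ∷ J ∷ J ∷ T)
      ≡⟨ cong (suc j′ +_) (trans (durfeeFrom-∷-≤ (n≤1+n _))
           (cong suc (trans (durfeeFrom-∷-≤ ≤-refl) (cong suc (durfeeFrom-∷-< ≤-refl))))) ⟩
    suc j′ + 2
      ≡⟨ cong suc (+-comm j′ 2) ⟩
    J ∎
    where open ≡-Reasoning

  dβ-image : dβ μ ≡ J ∷ T
  dβ-image = trans (cong (λ d → drop d μ) (trans durfee-image (cong suc (+-comm 2 j′))))
                   (drop-++ A (J ∷ J ∷ J ∷ T) (suc j′) 2 length-A)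

  conj-image-J+1 : conj μ (suc J) ≤ suc j′
  conj-image-J+1 = begin
    conj μ (suc J)                                 ≡⟨ conj-++ A (J ∷ J ∷ J ∷ T) (suc J) ⟩
    conj A (suc J) + conj (J ∷ J ∷ J ∷ T) (suc J)  ≡⟨ cong (conj A (suc J) +_) (conj-none _ _ rest-<) ⟩
    conj A (suc J) + 0                             ≡⟨ +-identityʳ _ ⟩
    conj A (suc J)                                 ≤⟨ conj-≤-length A (suc J) ⟩
    length A                                       ≡⟨ length-A ⟩
    suc j′                                         ∎
    where
    open ≤-Reasoning
    rest-< : All (_< suc J) (J ∷ J ∷ J ∷ T)
    rest-< = ≤-refl ∷ ≤-refl ∷ ≤-refl ∷ All.map s≤s T-≤

  durfee<part₁ : durfee μ < part μ 1
  durfee<part₁ = begin-strict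
    durfee μ        ≡⟨ durfee-image ⟩
    3 + j′          <⟨ s≤s (s≤s (s≤s (s≤s (m≤n⇒m≤1+n (m≤m+n j′ p))))) ⟩
    5 + j′ + p      ≤⟨ m≤m+n (5 + j′ + p) q ⟩
    5 + j′ + p + q  ≡⟨ c-2 ⟨
    part μ 1        ∎
    where open ≤-Reasoning

  γ₁+2≤durfee : part (dα μ) 1 + 2 ≤ durfee μ
  γ₁+2≤durfee = begin
    part (dα μ) 1 + 2                  ≡⟨ cong (_+ 2) (part-dα μ 0 (m<n⇒0<n∸m durfee<part₁)) ⟩
    conj μ (suc (durfee μ + 0)) + 2    ≡⟨ cong (λ d → conj μ (suc d) + 2) (trans (+-identityʳ _) durfee-image) ⟩
    conj μ (suc J) + 2                 ≤⟨ +-monoˡ-≤ 2 conj-image-J+1 ⟩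
    suc j′ + 2                         ≡⟨ cong suc (+-comm j′ 2) ⟩
    J                                  ≡⟨ durfee-image ⟨
    durfee μ                           ∎
    where open ≤-Reasoning

  inPbar3 : InPbar3 n μ
  inPbar3 = ((descending , positive , sum-image) , ≤-reflexive (trans length-image (sym c-2)))
          , subst (1 ≤_) (sym durfee-image) (s≤s z≤n)
          , trans (length-dα μ) (trans (cong (_∸ durfee μ) (trans c-2 (sym length-image))) (sym (length-dβ μ)))
          , γ₁+2≤durfee
          , trans (cong (λ β → part β 1) dβ-image) (sym durfee-image)
          , trans (cong s dβ-image) (s-++-replicate-1 (J ∷ M) q (s≤s z≤n ∷ All.map (≤-trans (s≤s z≤n)) M-≥))

image-durfee-side-injective : ∀ {c₁ c₂ : ℕ → ℕ} {j₁ j₂ p₁ p₂ q₁ q₂ n₁ n₂} →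
  Qbar3Columns c₁ j₁ p₁ q₁ n₁ → Qbar3Columns c₂ j₂ p₂ q₂ n₂ → image c₁ j₁ p₁ q₁ ≡ image c₂ j₂ p₂ q₂ → j₁ ≡ j₂
image-durfee-side-injective H₁ H₂ eq = suc-injective (suc-injective (suc-injective
  (trans (sym (Image.durfee-image H₁)) (trans (cong durfee eq) (Image.durfee-image H₂)))))

image-blocks-injective : ∀ {c₁ c₂ : ℕ → ℕ} {j p₁ p₂ q₁ q₂ n₁ n₂} →
  Qbar3Columns c₁ j p₁ q₁ n₁ → Qbar3Columns c₂ j p₂ q₂ n₂ → image c₁ j p₁ q₁ ≡ image c₂ j p₂ q₂ →
  segment c₁ 2 (suc j) ≡ segment c₂ 2 (suc j) × segment c₁ (5 + j) p₁ ≡ segment c₂ (5 + j) p₂ × q₁ ≡ q₂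
image-blocks-injective H₁ H₂ eq
  with A≡ , rest≡ ← ++-injective _ _ _ _ (trans (Image.length-A H₁) (sym (Image.length-A H₂))) eq
  with M≡ , q≡ ← ++-replicate-1-injective _ _ _ _ (Image.M-≥ H₁) (Image.M-≥ H₂)
                   (∷-injectiveʳ (∷-injectiveʳ (∷-injectiveʳ rest≡)))
  = A≡ , map-injective suc-injective M≡ , suc-injective q≡

image-injective : ∀ {c₁ c₂ : ℕ → ℕ} {j₁ j₂ p₁ p₂ q₁ q₂ n₁ n₂} →
                  Qbar3Columns c₁ j₁ p₁ q₁ n₁ → Qbar3Columns c₂ j₂ p₂ q₂ n₂ →
                  image c₁ j₁ p₁ q₁ ≡ image c₂ j₂ p₂ q₂ → ∀ k → 1 ≤ k → c₁ k ≡ c₂ k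
image-injective {c₁} {c₂} {j} {_} {p₁} {p₂} H₁ H₂ eq (suc k) _
  with refl ← image-durfee-side-injective H₁ H₂ eq
  with A≡ , S≡ , refl ← image-blocks-injective H₁ H₂ eq
  with refl ← trans (sym (length-segment c₁ (5 + j) p₁)) (trans (cong length S≡) (length-segment c₂ (5 + j) p₂))
  with k <? 5 + j + p₁
... | yes k< = segment-injective c₁ c₂ 1 (5 + j + p₁) columns≡ k k<
  where
  module H₁ = Qbar3Columns H₁
  module H₂ = Qbar3Columns H₂
  columns≡ : segment c₁ 1 (5 + j + p₁) ≡ segment c₂ 1 (5 + j + p₁)
  columns≡ = trans (segment-split c₁ j p₁) (trans
    (cong₂ _∷_ (trans H₁.c-1 (sym H₂.c-1)) (cong₂ _++_ A≡
      (cong₂ _∷_ (trans H₁.c-durfee+1 (sym H₂.c-durfee+1)) (cong₂ _∷_ (trans H₁.c-durfee+2 (sym H₂.c-durfee+2))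
        (cong₂ _++_ S≡ (cong (_∷ []) (trans H₁.c-λ₁ (sym H₂.c-λ₁))))))))
    (sym (segment-split c₂ j p₁)))
... | no  k≮ = trans (Qbar3Columns.c-beyond H₁ (suc k) (≰⇒> k≮)) (sym (Qbar3Columns.c-beyond H₂ (suc k) (≰⇒> k≮)))

module FromQbar3 {n : ℕ} {μ : List ℕ}
  (descending : Descending μ) (positive : All (0 <_) μ) (sum-μ : sum μ ≡ n) (0∈rank-set : InRankSet 0ℤ μ)
  (1≤j : 1 ≤ durfee μ) (ℓα<ℓβ : suc (ℓ (dα μ)) ≤ ℓ (dβ μ))
  (α₁≡j : part (dα μ) 1 ≡ durfee μ) (α₂≡j : part (dα μ) 2 ≡ durfee μ)
  (sα≡1 : s (dα μ) ≡ just 1) (sβ≡2 : s (dβ μ) ≡ just 2) where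

  j a L : ℕ
  j = durfee μ
  a = part μ 1
  L = length μ

  c : ℕ → ℕ
  c = conj μ

  j≢0 : j ≢ 0
  j≢0 = ≢-sym (<⇒≢ 1≤j)

  λ-j+1≡j : part μ (suc j) ≡ j
  λ-j+1≡j = InRankSet-0⇒part-durfee μ descending 0∈rank-set

  2≤a∸j : 2 ≤ a ∸ j
  2≤a∸j with 2 ≤? a ∸ j
  ... | yes 2≤ = 2≤
  ... | no  2≰ = contradiction (trans (sym α₂≡j) (part-dα-≥ μ 1 (≤-pred (≰⇒> 2≰)))) j≢0

  c-j+1 : c (1 + j) ≡ j
  c-j+1 = trans (cong (λ k → c (suc k)) (sym (+-identityʳ j))) (trans (sym (part-dα μ 0 (≤-trans (s≤s z≤n) 2≤a∸j))) α₁≡j)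

  c-j+2 : c (2 + j) ≡ j
  c-j+2 = trans (cong (λ k → c (suc k)) (+-comm 1 j)) (trans (sym (part-dα μ 1 2≤a∸j)) α₂≡j)

  β-≥2 : All (2 ≤_) (dβ μ)
  β-≥2 = s≡just⇒All-≥ (dβ μ) 2 sβ≡2

  j<L : j < L
  j<L = part≢0⇒<length μ j (λ λ≡0 → contradiction (trans (sym λ-j+1≡j) λ≡0) j≢0)

  2≤j : 2 ≤ j
  2≤j = subst (2 ≤_) λ-j+1≡j (All-part-drop μ j j β-≥2 ≤-refl j<L)

  j<a : j < a
  j<a = m∸n≢0⇒n<m (λ a∸j≡0 → contradiction (subst (2 ≤_) a∸j≡0 2≤a∸j) λ ())

  All-≤a : All (_≤ a) μ
  All-≤a = All-≤-part₁ μ descending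

  c-1 : c 1 ≡ L
  c-1 = conj-all μ 1 positive

  c-2 : c 2 ≡ L
  c-2 with o , 1+j+o≡L ← m≤n⇒∃[o]m+o≡n j<L =
    ≤-antisym (conj-≤-length μ 2)
      (subst (_≤ c 2) 1+j+o≡L (≤-part⇒≤-conj μ (j + o) descending (s≤s z≤n)
        (All-part-drop μ j (j + o) β-≥2 (m≤m+n j o) (≤-reflexive 1+j+o≡L))))

  c-j : suc j ≤ c j
  c-j = ≤-part⇒≤-conj μ j descending 1≤j (≤-reflexive (sym λ-j+1≡j))

  c-a : c a ≡ 1
  c-a with i , i<ℓα , αᵢ≡1 ← s≡just⇒∃part (dα μ) 1 sα≡1 =
    ≤-antisym (begin
      c a                 ≤⟨ conj-antitone μ (m<n∸o⇒o+m<n i a j i<a∸j) ⟩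
      c (suc (j + i))     ≡⟨ part-dα μ i i<a∸j ⟨
      part (dα μ) (suc i) ≡⟨ αᵢ≡1 ⟩
      1                   ∎)
    (≤-part⇒≤-conj μ 0 descending (≤-trans 1≤j (<⇒≤ j<a)) ≤-refl)
    where
    open ≤-Reasoning
    i<a∸j : i < a ∸ j
    i<a∸j = subst (i <_) (length-dα μ) i<ℓα

  3+j≤a : 3 + j ≤ a
  3+j≤a with 3 ≤? a ∸ j
  ... | yes 3≤a∸j = subst (_≤ a) (trans (sym (+-suc j 2)) (+-comm j 3)) (m<n∸o⇒o+m<n 2 a j 3≤a∸j)
  ... | no  3≰a∸j = contradiction (trans (sym c-a) (trans (cong c a≡2+j) c-j+2)) (<⇒≢ 2≤j)
    where
    a≡2+j : a ≡ 2 + j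
    a≡2+j = begin
      a              ≡⟨ m+[n∸m]≡n (<⇒≤ j<a) ⟨
      j + (a ∸ j)    ≡⟨ cong (j +_) (≤-antisym (≤-pred (≰⇒> 3≰a∸j)) 2≤a∸j) ⟩
      j + 2          ≡⟨ +-comm j 2 ⟩
      2 + j          ∎
      where open ≡-Reasoning

  a<L : a < L
  a<L = subst (_< L) (m+[n∸m]≡n (<⇒≤ j<a))
    (m<n∸o⇒o+m<n (a ∸ j) L j (subst₂ (λ x y → suc x ≤ y) (length-dα μ) (length-dβ μ) ℓα<ℓβ))

  c-beyond : ∀ k → a < k → c k ≡ 0
  c-beyond k a<k = conj-none μ k (All.map (λ x≤a → ≤-<-trans x≤a a<k) All-≤a)

  sum-c : sum (segment c 1 a) ≡ n
  sum-c = trans (sum-segment-conj μ a All-≤a) sum-μ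

  columns : Qbar3Columns c (j ∸ 2) (a ∸ (3 + j)) (L ∸ a) n
  columns = qbar3Columns-intro (sym (m+[n∸m]≡n 2≤j)) (sym (m+[n∸m]≡n 3+j≤a)) (sym (m+[n∸m]≡n (<⇒≤ a<L)))
    (conj-antitone μ) c-1 c-2 c-j c-j+1 c-j+2 c-a c-beyond sum-c

InQbar3⇒Qbar3Columns : ∀ {n μ} → InQbar3 n μ →
  Qbar3Columns (conj μ) (durfee μ ∸ 2) (part μ 1 ∸ (3 + durfee μ)) (length μ ∸ part μ 1) n
InQbar3⇒Qbar3Columns (((descending , positive , sum-μ) , 0∈rank-set) , 1≤j , ℓα<ℓβ , α₁≡j , α₂≡j , sα≡1 , sβ≡2) =
  FromQbar3.columns descending positive sum-μ 0∈rank-set 1≤j ℓα<ℓβ α₁≡j α₂≡j sα≡1 sβ≡2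

lemma5p3 : (n : ℕ) → Σ (Qbar3 n → Pbar3 n) (λ f →
             (x y : Qbar3 n) → proj₁ (f x) ≡ proj₁ (f y) → proj₁ x ≡ proj₁ y)
lemma5p3 n = φ , φ-injective
  where
  φ : Qbar3 n → Pbar3 n
  φ (μ , μ∈Qbar3) = image (conj μ) (durfee μ ∸ 2) (part μ 1 ∸ (3 + durfee μ)) (length μ ∸ part μ 1)
                  , Image.inPbar3 (InQbar3⇒Qbar3Columns μ∈Qbar3)

  φ-injective : (x y : Qbar3 n) → proj₁ (φ x) ≡ proj₁ (φ y) → proj₁ x ≡ proj₁ y
  φ-injective (μ , μ∈Qbar3@(((dμ , pμ , _) , _) , _)) (ν , ν∈Qbar3@(((dν , pν , _) , _) , _)) eq =
    conj-injective μ ν dμ dν pμ pν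
      (image-injective (InQbar3⇒Qbar3Columns μ∈Qbar3) (InQbar3⇒Qbar3Columns ν∈Qbar3) eq)
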